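{- Let $(\mathcal{C},\otimes,I,\multimap)$ be a symmetric monoidal closed category, let $n\in\mathbb{N}$ and let $X_0,\dots,X_n,Y_0,\dots,Y_n$ be objects of $\mathcal{C}$. Define objects $Z_n:=X_n\multimap Y_n$ and, for $i=n-1,\dots,0$, $Z_i:=X_i\multimap(Z_{i+1}\otimes Y_i)$ (so $Z_0=X_0\multimap(X_1\multimap\cdots(X_{n-1}\multimap(X_n\multimap Y_n)\otimes Y_{n-1})\cdots)\otimes Y_0)$). Then $$\mathrm{Comb}_n(X,Y)\cong\mathcal{C}(I,Z_0).$$
   Context: Here $X\multimap -$ denotes the right adjoint of $-\otimes X$ (internal hom). The set of $n$-combs is the coend in sets $$\mathrm{Comb}_n(X,Y)=\int^{M_0,\dots,M_{n-1}\in\mathcal{C}}\prod_{i=0}^{n}\mathcal{C}(M_{i-1}\otimes X_i,\,M_i\otimes Y_i),\quad M_{ -1}=M_n:=I.$$ -}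

module Defs where

open import Level using (Level; _⊔_)
open import Data.Nat using (ℕ; zero; suc)
open import Data.Fin using (Fin; zero; suc)
open import Data.Product using (Σ; _,_; proj₁; proj₂)
open import Relation.Binary using (Rel; Setoid; IsEquivalence)
import Relation.Binary.Construct.Closure.Equivalence as EqC

record Category (o ℓ e : Level) : Set (Level.suc (o ⊔ ℓ ⊔ e)) where
  infixr 9 _∘_
  infix 4 _≈_
  field
    Obj   : Set o
    Hom   : Obj → Obj → Set ℓ
    _≈_   : ∀ {A B} → Rel (Hom A B) e
    ≈-equiv : ∀ {A B} → IsEquivalence (_≈_ {A} {B})
    id    : ∀ {A} → Hom A A
    _∘_   : ∀ {A B C} → Hom B C → Hom A B → Hom A C
    assoc : ∀ {A B C D} {f : Hom A B} {g : Hom B C} {h : Hom C D} →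
            (h ∘ g) ∘ f ≈ h ∘ (g ∘ f)
    identityˡ : ∀ {A B} {f : Hom A B} → id ∘ f ≈ f
    identityʳ : ∀ {A B} {f : Hom A B} → f ∘ id ≈ f
    ∘-resp-≈ : ∀ {A B C} {f h : Hom B C} {g i : Hom A B} →
               f ≈ h → g ≈ i → f ∘ g ≈ h ∘ i

  homSetoid : Obj → Obj → Setoid ℓ e
  homSetoid A B = record { Carrier = Hom A B ; _≈_ = _≈_ ; isEquivalence = ≈-equiv }

record SMCC (o ℓ e : Level) : Set (Level.suc (o ⊔ ℓ ⊔ e)) where
  field
    cat : Category o ℓ e
  open Category cat public
  infixr 10 _⊗₀_ _⊗₁_
  infixr 5 _⊸_
  field
    _⊗₀_ : Obj → Obj → Obj
    _⊗₁_ : ∀ {A B C D} → Hom A B → Hom C D → Hom (A ⊗₀ C) (B ⊗₀ D)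
    ⊗-identity : ∀ {A B} → id {A} ⊗₁ id {B} ≈ id
    ⊗-homomorphism : ∀ {A B C D E F} {f : Hom A B} {g : Hom B C} {h : Hom D E} {k : Hom E F} →
                     (g ∘ f) ⊗₁ (k ∘ h) ≈ (g ⊗₁ k) ∘ (f ⊗₁ h)
    ⊗-resp-≈ : ∀ {A B C D} {f f' : Hom A B} {g g' : Hom C D} →
               f ≈ f' → g ≈ g' → f ⊗₁ g ≈ f' ⊗₁ g'
    unit : Obj
    α⇒ : ∀ {A B C} → Hom ((A ⊗₀ B) ⊗₀ C) (A ⊗₀ (B ⊗₀ C))
    α⇐ : ∀ {A B C} → Hom (A ⊗₀ (B ⊗₀ C)) ((A ⊗₀ B) ⊗₀ C)
    λ⇒ : ∀ {A} → Hom (unit ⊗₀ A) A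
    λ⇐ : ∀ {A} → Hom A (unit ⊗₀ A)
    ρ⇒ : ∀ {A} → Hom (A ⊗₀ unit) A
    ρ⇐ : ∀ {A} → Hom A (A ⊗₀ unit)
    α-isoˡ : ∀ {A B C} → α⇐ {A} {B} {C} ∘ α⇒ ≈ id
    α-isoʳ : ∀ {A B C} → α⇒ {A} {B} {C} ∘ α⇐ ≈ id
    λ-isoˡ : ∀ {A} → λ⇐ {A} ∘ λ⇒ ≈ id
    λ-isoʳ : ∀ {A} → λ⇒ {A} ∘ λ⇐ ≈ id
    ρ-isoˡ : ∀ {A} → ρ⇐ {A} ∘ ρ⇒ ≈ id
    ρ-isoʳ : ∀ {A} → ρ⇒ {A} ∘ ρ⇐ ≈ id
    α-natural : ∀ {A B C A' B' C'} {f : Hom A A'} {g : Hom B B'} {h : Hom C C'} →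
                α⇒ ∘ ((f ⊗₁ g) ⊗₁ h) ≈ (f ⊗₁ (g ⊗₁ h)) ∘ α⇒
    λ-natural : ∀ {A B} {f : Hom A B} → λ⇒ ∘ (id ⊗₁ f) ≈ f ∘ λ⇒
    ρ-natural : ∀ {A B} {f : Hom A B} → ρ⇒ ∘ (f ⊗₁ id) ≈ f ∘ ρ⇒
    pentagon : ∀ {A B C D} →
               (id {A} ⊗₁ α⇒ {B} {C} {D}) ∘ α⇒ ∘ (α⇒ ⊗₁ id) ≈ α⇒ ∘ α⇒
    triangle : ∀ {A B} → (id {A} ⊗₁ λ⇒ {B}) ∘ α⇒ ≈ ρ⇒ ⊗₁ id
    σ : ∀ {A B} → Hom (A ⊗₀ B) (B ⊗₀ A)
    σ-natural : ∀ {A B A' B'} {f : Hom A A'} {g : Hom B B'} →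
                σ ∘ (f ⊗₁ g) ≈ (g ⊗₁ f) ∘ σ
    σ-involutive : ∀ {A B} → σ {B} {A} ∘ σ {A} {B} ≈ id
    hexagon : ∀ {A B C} →
              (id {B} ⊗₁ σ {A} {C}) ∘ α⇒ ∘ (σ ⊗₁ id) ≈ α⇒ ∘ σ ∘ α⇒
    _⊸_ : Obj → Obj → Obj
    eval : ∀ {X Y} → Hom ((X ⊸ Y) ⊗₀ X) Y
    curry : ∀ {A X Y} → Hom (A ⊗₀ X) Y → Hom A (X ⊸ Y)
    curry-resp-≈ : ∀ {A X Y} {f g : Hom (A ⊗₀ X) Y} → f ≈ g → curry f ≈ curry g
    β : ∀ {A X Y} {f : Hom (A ⊗₀ X) Y} → eval ∘ (curry f ⊗₁ id) ≈ f
    η : ∀ {A X Y} {g : Hom A (X ⊸ Y)} → curry (eval ∘ (g ⊗₁ id)) ≈ g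

module Combs {o ℓ e} (𝒞 : SMCC o ℓ e) where
  open SMCC 𝒞

  -- Given M₀,…,M_{n-1}, the object M_i for i = 0..n with M_n := I.
  Mout : ∀ {n} → (Fin n → Obj) → Fin (suc n) → Obj
  Mout {zero}  M zero    = unit
  Mout {suc n} M zero    = M zero
  Mout {suc n} M (suc i) = Mout (λ j → M (suc j)) i

  -- The object M_{i-1} for i = 0..n with M_{-1} := I.
  Min : ∀ {n} → (Fin n → Obj) → Fin (suc n) → Obj
  Min M zero    = unit
  Min M (suc j) = M j

  -- Extending a family h_j : M_j → M'_j (j < n) by h_{-1} = h_n = id_I.
  Hout : ∀ {n} (M M' : Fin n → Obj) → (∀ j → Hom (M j) (M' j)) →
         ∀ i → Hom (Mout M i) (Mout M' i)
  Hout {zero}  M M' h zero    = id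
  Hout {suc n} M M' h zero    = h zero
  Hout {suc n} M M' h (suc i) = Hout (λ j → M (suc j)) (λ j → M' (suc j)) (λ j → h (suc j)) i

  Hin : ∀ {n} (M M' : Fin n → Obj) → (∀ j → Hom (M j) (M' j)) →
        ∀ i → Hom (Min M i) (Min M' i)
  Hin M M' h zero    = id
  Hin M M' h (suc j) = h j

  -- Elements of ∏_{i=0}^{n} C(M_{i-1} ⊗ X_i, M_i ⊗ Y_i), summed over all M.
  PreComb : (n : ℕ) (X Y : Fin (suc n) → Obj) → Set (o ⊔ ℓ)
  PreComb n X Y = Σ (Fin n → Obj) λ M →
    (i : Fin (suc n)) → Hom (Min M i ⊗₀ X i) (Mout M i ⊗₀ Y i)

  -- Generating relation of the coend (in setoids):
  data CombStep (n : ℕ) (X Y : Fin (suc n) → Obj) :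
                PreComb n X Y → PreComb n X Y → Set (o ⊔ ℓ ⊔ e) where
    pointwise : ∀ {M} {f g : ∀ i → Hom (Min M i ⊗₀ X i) (Mout M i ⊗₀ Y i)} →
                (∀ i → f i ≈ g i) → CombStep n X Y (M , f) (M , g)
    -- dinaturality: for h : M → M' and g ∈ P(M', M),
    -- P(h, id) g ~ P(id, h) g
    dinat : ∀ (M M' : Fin n → Obj) (h : ∀ j → Hom (M j) (M' j))
              (g : ∀ i → Hom (Min M' i ⊗₀ X i) (Mout M i ⊗₀ Y i)) →
            CombStep n X Y
              (M  , λ i → g i ∘ (Hin M M' h i ⊗₁ id))
              (M' , λ i → (Hout M M' h i ⊗₁ id) ∘ g i)

  -- Comb_n(X,Y) as a setoid: the coend ∫^{M₀..M_{n-1}} ∏_i C(M_{i-1}⊗X_i, M_i⊗Y_i).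
  Comb : (n : ℕ) (X Y : Fin (suc n) → Obj) → Setoid (o ⊔ ℓ) (o ⊔ ℓ ⊔ e)
  Comb n X Y = EqC.setoid (CombStep n X Y)

  Z₀ : (n : ℕ) (X Y : Fin (suc n) → Obj) → Obj
  Z₀ zero    X Y = X zero ⊸ Y zero
  Z₀ (suc n) X Y = X zero ⊸ (Z₀ n (λ i → X (suc i)) (λ i → Y (suc i)) ⊗₀ Y zero)

module Submission where

-- The tail of a comb (everything after its first box) is again a comb, but
-- its first box has input M₀ ⊗ X₁ rather than I ⊗ X₁.  We therefore prove the
-- stronger statement  GComb_n(A; X, Y) ≅ C(A, Z₀)  for combs whose first box
-- has an arbitrary input object A, by induction on n:
--   * curryComb folds a comb into a morphism A → Z₀ by currying box after
--     box; it respects the coend relation because currying is natural in A.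
--   * canonical k unfolds k : A → Z₀ into the comb with wires Z₁, …, Z_n and
--     evaluation maps as boxes; curryComb (canonical k) ≈ k by β and η.
--   * every comb t is related to canonical (curryComb t): split off the first
--     box, use induction on the tail, and slide the resulting morphism
--     M₀ → Z₁ along the first wire by one dinaturality step.
-- Official combs are exactly the combs with input object I, so the theorem
-- is the composite of these two isomorphisms of setoids.

open import Defs
open import Level using (Level; _⊔_)
open import Data.Nat using (ℕ; zero; suc)
open import Data.Fin using (Fin; zero; suc)
open import Data.Product using (_,_)
open import Data.Vec.Functional using ([]; _∷_)
open import Function.Bundles using (Inverse)
import Function.Construct.Composition as Composition
open import Relation.Binary using (Rel; IsEquivalence; Setoid)
import Relation.Binary.Construct.Closure.Equivalence as EqC
import Relation.Binary.Reasoning.Setoid as SetoidReasoning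

module CombRepresentation {o ℓ e : Level} (𝒞 : SMCC o ℓ e) where
  open SMCC 𝒞
  open Combs 𝒞

  module ≈ {A B : Obj} = IsEquivalence (≈-equiv {A} {B})
  module HomReasoning {A B : Obj} = SetoidReasoning (homSetoid A B)

  cancel-id⊗idʳ : ∀ {A B C} {f : Hom (A ⊗₀ B) C} → f ∘ (id ⊗₁ id) ≈ f
  cancel-id⊗idʳ = ≈.trans (∘-resp-≈ ≈.refl ⊗-identity) identityʳ

  cancel-id⊗idˡ : ∀ {A B C} {f : Hom C (A ⊗₀ B)} → (id ⊗₁ id) ∘ f ≈ f
  cancel-id⊗idˡ = ≈.trans (∘-resp-≈ ⊗-identity ≈.refl) identityˡ

  ⊗id-homomorphism : ∀ {A B C D} {f : Hom B C} {g : Hom A B} →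
                     (f ∘ g) ⊗₁ id {D} ≈ (f ⊗₁ id) ∘ (g ⊗₁ id)
  ⊗id-homomorphism = ≈.trans (⊗-resp-≈ ≈.refl (≈.sym identityˡ)) ⊗-homomorphism

  curry-natural : ∀ {A A' X Y} (f : Hom (A ⊗₀ X) Y) (k : Hom A' A) →
                  curry f ∘ k ≈ curry (f ∘ (k ⊗₁ id))
  curry-natural f k = begin
    curry f ∘ k                                 ≈⟨ η ⟨
    curry (eval ∘ ((curry f ∘ k) ⊗₁ id))        ≈⟨ curry-resp-≈ (∘-resp-≈ ≈.refl ⊗id-homomorphism) ⟩
    curry (eval ∘ ((curry f ⊗₁ id) ∘ (k ⊗₁ id))) ≈⟨ curry-resp-≈ assoc ⟨
    curry ((eval ∘ (curry f ⊗₁ id)) ∘ (k ⊗₁ id)) ≈⟨ curry-resp-≈ (∘-resp-≈ β ≈.refl) ⟩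
    curry (f ∘ (k ⊗₁ id))                       ∎
    where open HomReasoning

  Hout-id : ∀ {n} (N : Fin n → Obj) i → Hout N N (λ _ → id) i ≈ id
  Hout-id {zero}  N zero    = ≈.refl
  Hout-id {suc n} N zero    = ≈.refl
  Hout-id {suc n} N (suc i) = Hout-id (λ j → N (suc j)) i

  -- A comb whose first box has input A ⊗ X₀ instead of I ⊗ X₀: wires
  -- M₀, …, M_{n-1} (followed by M_n = I) and boxes connecting them.
  record GComb (n : ℕ) (A : Obj) (X Y : Fin (suc n) → Obj) : Set (o ⊔ ℓ) where
    constructor gcomb
    field
      M     : Fin n → Obj
      first : Hom (A ⊗₀ X zero) (Mout M zero ⊗₀ Y zero)
      rest  : ∀ i → Hom (M i ⊗₀ X (suc i)) (Mout M (suc i) ⊗₀ Y (suc i))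

  data GStep {n : ℕ} {A : Obj} {X Y : Fin (suc n) → Obj} :
             Rel (GComb n A X Y) (o ⊔ ℓ ⊔ e) where
    boxwise : ∀ {M f₀ g₀ fs gs} → f₀ ≈ g₀ → (∀ i → fs i ≈ gs i) →
              GStep (gcomb M f₀ fs) (gcomb M g₀ gs)
    slide : ∀ M M' (h : ∀ j → Hom (M j) (M' j)) g₀
              (gs : ∀ i → Hom (M' i ⊗₀ X (suc i)) (Mout M (suc i) ⊗₀ Y (suc i))) →
            GStep (gcomb M g₀ (λ i → gs i ∘ (h i ⊗₁ id)))
                  (gcomb M' ((Hout M M' h zero ⊗₁ id) ∘ g₀)
                            (λ i → (Hout M M' h (suc i) ⊗₁ id) ∘ gs i))

  GCombs : (n : ℕ) (A : Obj) (X Y : Fin (suc n) → Obj) → Setoid (o ⊔ ℓ) (o ⊔ ℓ ⊔ e)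
  GCombs n A X Y = EqC.setoid (GStep {n} {A} {X} {Y})

  _~_ : ∀ {n A X Y} → Rel (GComb n A X Y) (o ⊔ ℓ ⊔ e)
  _~_ = EqC.EqClosure GStep

  step : ∀ {n A X Y} {s t : GComb n A X Y} → GStep s t → s ~ t
  step = EqC.return

  tail : ∀ {n A X Y} (t : GComb (suc n) A X Y) →
         GComb n (GComb.M t zero) (λ i → X (suc i)) (λ i → Y (suc i))
  tail (gcomb M f₀ fs) = gcomb (λ j → M (suc j)) (fs zero) (λ i → fs (suc i))

  precompose : ∀ {n A A' X Y} → Hom A' A → GComb n A X Y → GComb n A' X Y
  precompose k (gcomb M f₀ fs) = gcomb M (f₀ ∘ (k ⊗₁ id)) fs

  curryComb : ∀ {n A X Y} → GComb n A X Y → Hom A (Z₀ n X Y)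
  curryComb {zero}  (gcomb _ f₀ _)    = curry (λ⇒ ∘ f₀)
  curryComb {suc n} t@(gcomb _ f₀ _) = curry ((curryComb (tail t) ⊗₁ id) ∘ f₀)

  curryComb-precompose : ∀ {n A A' X Y} (k : Hom A' A) (t : GComb n A X Y) →
                         curryComb (precompose k t) ≈ curryComb t ∘ k
  curryComb-precompose {zero} k (gcomb _ f₀ _) =
    ≈.trans (curry-resp-≈ (≈.sym assoc)) (≈.sym (curry-natural (λ⇒ ∘ f₀) k))
  curryComb-precompose {suc n} k t@(gcomb _ f₀ _) =
    ≈.trans (curry-resp-≈ (≈.sym assoc)) (≈.sym (curry-natural ((curryComb (tail t) ⊗₁ id) ∘ f₀) k))

  -- curryComb is invariant under the generating relation; sliding maps along
  -- the tail turns, one level up, into precomposition (curryComb-precompose).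
  curryComb-step : ∀ {n A X Y} {s t : GComb n A X Y} → GStep s t → curryComb s ≈ curryComb t
  curryComb-step {zero} (boxwise p _) = curry-resp-≈ (∘-resp-≈ ≈.refl p)
  curryComb-step {suc n} (boxwise p ps) =
    curry-resp-≈ (∘-resp-≈ (⊗-resp-≈ (curryComb-step (boxwise (ps zero) (λ i → ps (suc i)))) ≈.refl) p)
  curryComb-step {zero} (slide _ _ _ _ _) = curry-resp-≈ (∘-resp-≈ ≈.refl (≈.sym cancel-id⊗idˡ))
  curryComb-step {suc n} {A} {X} {Y} (slide M M' h g₀ gs) = curry-resp-≈ (begin
    (curryComb (precompose (h zero) tailₗ) ⊗₁ id) ∘ g₀ ≈⟨ ∘-resp-≈ (⊗-resp-≈ slid ≈.refl) ≈.refl ⟩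
    ((curryComb tailᵣ ∘ h zero) ⊗₁ id) ∘ g₀            ≈⟨ ∘-resp-≈ ⊗id-homomorphism ≈.refl ⟩
    ((curryComb tailᵣ ⊗₁ id) ∘ (h zero ⊗₁ id)) ∘ g₀    ≈⟨ assoc ⟩
    (curryComb tailᵣ ⊗₁ id) ∘ ((h zero ⊗₁ id) ∘ g₀)    ∎)
    where
      open HomReasoning
      tailₗ tailᵣ : GComb n (M' zero) (λ i → X (suc i)) (λ i → Y (suc i))
      tailₗ = gcomb (λ j → M (suc j)) (gs zero) (λ i → gs (suc i) ∘ (h (suc i) ⊗₁ id))
      tailᵣ = gcomb (λ j → M' (suc j)) ((Hout M M' h (suc zero) ⊗₁ id) ∘ gs zero)
                    (λ i → (Hout M M' h (suc (suc i)) ⊗₁ id) ∘ gs (suc i))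
      slid : curryComb (precompose (h zero) tailₗ) ≈ curryComb tailᵣ ∘ h zero
      slid = ≈.trans (curryComb-precompose (h zero) tailₗ)
                     (∘-resp-≈ (curryComb-step (slide (λ j → M (suc j)) (λ j → M' (suc j))
                                                      (λ j → h (suc j)) (gs zero) (λ i → gs (suc i))))
                               ≈.refl)

  curryComb-cong : ∀ {n A X Y} {s t : GComb n A X Y} → s ~ t → curryComb s ≈ curryComb t
  curryComb-cong = EqC.gfold ≈-equiv curryComb curryComb-step

  consBoxes : ∀ {n A} {X Y : Fin (suc n) → Obj} {N N' : Fin n → Obj} →
              Hom (A ⊗₀ X zero) (Mout N zero ⊗₀ Y zero) →
              (∀ i → Hom (N' i ⊗₀ X (suc i)) (Mout N (suc i) ⊗₀ Y (suc i))) →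
              ∀ i → Hom ((A ∷ N') i ⊗₀ X i) (Mout N i ⊗₀ Y i)
  consBoxes g₀ gs zero    = g₀
  consBoxes g₀ gs (suc i) = gs i

  cons : ∀ {n A B X Y} → Hom (B ⊗₀ X zero) (A ⊗₀ Y zero) →
         GComb n A (λ i → X (suc i)) (λ i → Y (suc i)) → GComb (suc n) B X Y
  cons {A = A} {X = X} {Y = Y} f₀ (gcomb N g₀ gs) =
    gcomb (A ∷ N) f₀ (consBoxes {X = λ i → X (suc i)} {Y = λ i → Y (suc i)} g₀ gs)

  _∷ʰ_ : ∀ {n A A'} {N N' : Fin n → Obj} →
         Hom A A' → (∀ j → Hom (N j) (N' j)) → ∀ j → Hom ((A ∷ N) j) ((A' ∷ N') j)
  (r ∷ʰ h) zero    = r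
  (r ∷ʰ h) (suc j) = h j

  cons-tail : ∀ {n A X Y} (t : GComb (suc n) A X Y) → t ~ cons (GComb.first t) (tail t)
  cons-tail {n} {A} {X} {Y} (gcomb M f₀ fs) = begin
    gcomb M f₀ fs
      ≈⟨ step (boxwise ≈.refl λ { zero → ≈.sym cancel-id⊗idʳ ; (suc i) → ≈.sym cancel-id⊗idʳ }) ⟩
    gcomb M f₀ (λ i → tailBoxes i ∘ (regroup i ⊗₁ id))
      ≈⟨ step (slide M (M zero ∷ M⁺) regroup f₀ tailBoxes) ⟩
    gcomb (M zero ∷ M⁺) ((id ⊗₁ id) ∘ f₀) (λ i → (Hout M⁺ M⁺ (λ _ → id) i ⊗₁ id) ∘ tailBoxes i)
      ≈⟨ step (boxwise cancel-id⊗idˡ (λ i → ≈.trans (∘-resp-≈ (⊗-resp-≈ (Hout-id M⁺ i) ≈.refl) ≈.refl)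
                                                     cancel-id⊗idˡ)) ⟩
    gcomb (M zero ∷ M⁺) f₀ tailBoxes
      ∎
    where
      open SetoidReasoning (GCombs (suc n) A X Y)
      M⁺ : Fin n → Obj
      M⁺ j = M (suc j)
      tailBoxes : ∀ i → Hom ((M zero ∷ M⁺) i ⊗₀ X (suc i)) (Mout M (suc i) ⊗₀ Y (suc i))
      tailBoxes = consBoxes (fs zero) (λ i → fs (suc i))
      regroup : ∀ j → Hom (M j) ((M zero ∷ M⁺) j)
      regroup zero    = id
      regroup (suc j) = id

  cons-step : ∀ {n A B X Y} (f₀ : Hom (B ⊗₀ X zero) (A ⊗₀ Y zero))
              {s t : GComb n A (λ i → X (suc i)) (λ i → Y (suc i))} →
              GStep s t → cons {X = X} {Y = Y} f₀ s ~ cons f₀ t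
  cons-step f₀ (boxwise p ps) = step (boxwise ≈.refl λ { zero → p ; (suc i) → ps i })
  cons-step {n} {A} {B} {X} {Y} f₀ (slide N N' h g₀ gs) = begin
    gcomb (A ∷ N) f₀ (consBoxes g₀ (λ i → gs i ∘ (h i ⊗₁ id)))
      ≈⟨ step (boxwise (≈.sym cancel-id⊗idʳ) λ { zero → ≈.sym cancel-id⊗idʳ ; (suc i) → ≈.refl }) ⟩
    gcomb (A ∷ N) (f₀ ∘ (id ⊗₁ id)) (λ i → boxes i ∘ ((id ∷ʰ h) i ⊗₁ id))
      ≈⟨ step (slide (A ∷ N) (A ∷ N') (id ∷ʰ h) (f₀ ∘ (id ⊗₁ id)) boxes) ⟩
    gcomb (A ∷ N') ((id ⊗₁ id) ∘ (f₀ ∘ (id ⊗₁ id)))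
          (λ i → (Hout (A ∷ N) (A ∷ N') (id ∷ʰ h) (suc i) ⊗₁ id) ∘ boxes i)
      ≈⟨ step (boxwise (≈.trans cancel-id⊗idˡ cancel-id⊗idʳ) λ { zero → ≈.refl ; (suc i) → ≈.refl }) ⟩
    gcomb (A ∷ N') f₀ (consBoxes ((Hout N N' h zero ⊗₁ id) ∘ g₀) (λ i → (Hout N N' h (suc i) ⊗₁ id) ∘ gs i))
      ∎
    where
      open SetoidReasoning (GCombs (suc n) B X Y)
      boxes : ∀ i → Hom ((A ∷ N') i ⊗₀ X (suc i)) (Mout N i ⊗₀ Y (suc i))
      boxes = consBoxes g₀ gs

  cons-cong : ∀ {n A B X Y} (f₀ : Hom (B ⊗₀ X zero) (A ⊗₀ Y zero))
              {s t : GComb n A (λ i → X (suc i)) (λ i → Y (suc i))} →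
              s ~ t → cons {X = X} {Y = Y} f₀ s ~ cons f₀ t
  cons-cong {X = X} {Y = Y} f₀ =
    EqC.gfold (EqC.isEquivalence GStep) (cons {X = X} {Y = Y} f₀) (cons-step f₀)

  -- A map r : M₀ → A precomposed to the tail slides along the first wire
  -- into the first box (dinaturality at the first wire).
  cons-precompose : ∀ {n A M₀ B X Y} (f₀ : Hom (B ⊗₀ X zero) (M₀ ⊗₀ Y zero)) (r : Hom M₀ A)
                    (s : GComb n A (λ i → X (suc i)) (λ i → Y (suc i))) →
                    cons {X = X} {Y = Y} f₀ (precompose r s) ~ cons ((r ⊗₁ id) ∘ f₀) s
  cons-precompose {n} {A} {M₀} {B} {X} {Y} f₀ r (gcomb N g₀ gs) = begin
    gcomb (M₀ ∷ N) f₀ (consBoxes (g₀ ∘ (r ⊗₁ id)) gs)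
      ≈⟨ step (boxwise ≈.refl λ { zero → ≈.refl ; (suc i) → ≈.sym cancel-id⊗idʳ }) ⟩
    gcomb (M₀ ∷ N) f₀ (λ i → boxes i ∘ ((r ∷ʰ (λ _ → id)) i ⊗₁ id))
      ≈⟨ step (slide (M₀ ∷ N) (A ∷ N) (r ∷ʰ (λ _ → id)) f₀ boxes) ⟩
    gcomb (A ∷ N) ((r ⊗₁ id) ∘ f₀) (λ i → (Hout N N (λ _ → id) i ⊗₁ id) ∘ boxes i)
      ≈⟨ step (boxwise ≈.refl (λ i → ≈.trans (∘-resp-≈ (⊗-resp-≈ (Hout-id N i) ≈.refl) ≈.refl)
                                              cancel-id⊗idˡ)) ⟩
    gcomb (A ∷ N) ((r ⊗₁ id) ∘ f₀) boxes
      ∎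
    where
      open SetoidReasoning (GCombs (suc n) B X Y)
      boxes : ∀ i → Hom ((A ∷ N) i ⊗₀ X (suc i)) (Mout N i ⊗₀ Y (suc i))
      boxes = consBoxes g₀ gs

  -- The canonical comb of k : A → Z₀: wires Z₁, …, Z_n, boxes uncurrying k
  -- and then the identities of Z₁, …, Z_n.
  canonical : ∀ n {A X Y} → Hom A (Z₀ n X Y) → GComb n A X Y
  canonical zero    k = gcomb [] (λ⇐ ∘ (eval ∘ (k ⊗₁ id))) (λ ())
  canonical (suc n) k = cons (eval ∘ (k ⊗₁ id)) (canonical n id)

  canonical-cong : ∀ n {A X Y} {k k' : Hom A (Z₀ n X Y)} → k ≈ k' → canonical n k ~ canonical n k'
  canonical-cong zero    p = step (boxwise (∘-resp-≈ ≈.refl (∘-resp-≈ ≈.refl (⊗-resp-≈ p ≈.refl))) (λ ()))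
  canonical-cong (suc n) p = step (boxwise (∘-resp-≈ ≈.refl (⊗-resp-≈ p ≈.refl)) (λ _ → ≈.refl))

  canonical-precompose : ∀ n {A X Y} (r : Hom A (Z₀ n X Y)) →
                         canonical n r ~ precompose r (canonical n id)
  canonical-precompose zero r =
    step (boxwise (≈.sym (≈.trans assoc (∘-resp-≈ ≈.refl (∘-resp-≈ cancel-id⊗idʳ ≈.refl)))) (λ ()))
  canonical-precompose (suc n) r =
    step (boxwise (≈.sym (∘-resp-≈ cancel-id⊗idʳ ≈.refl)) (λ _ → ≈.refl))

  curryComb-canonical : ∀ n {A X Y} (k : Hom A (Z₀ n X Y)) → curryComb (canonical n k) ≈ k
  curryComb-canonical zero k = begin
    curry (λ⇒ ∘ (λ⇐ ∘ (eval ∘ (k ⊗₁ id)))) ≈⟨ curry-resp-≈ (≈.sym assoc) ⟩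
    curry ((λ⇒ ∘ λ⇐) ∘ (eval ∘ (k ⊗₁ id))) ≈⟨ curry-resp-≈ (≈.trans (∘-resp-≈ λ-isoʳ ≈.refl) identityˡ) ⟩
    curry (eval ∘ (k ⊗₁ id))               ≈⟨ η ⟩
    k                                      ∎
    where open HomReasoning
  curryComb-canonical (suc n) k = begin
    curry ((curryComb (canonical n id) ⊗₁ id) ∘ (eval ∘ (k ⊗₁ id)))
      ≈⟨ curry-resp-≈ (∘-resp-≈ (⊗-resp-≈ (curryComb-canonical n id) ≈.refl) ≈.refl) ⟩
    curry ((id ⊗₁ id) ∘ (eval ∘ (k ⊗₁ id)))  ≈⟨ curry-resp-≈ cancel-id⊗idˡ ⟩
    curry (eval ∘ (k ⊗₁ id))                ≈⟨ η ⟩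
    k                                       ∎
    where open HomReasoning

  -- Every comb is related to the canonical comb of its curried morphism:
  -- by induction on the tail, followed by sliding the tail's curried
  -- morphism c along the first wire into the first box.
  canonical-curryComb : ∀ {n A X Y} (t : GComb n A X Y) → t ~ canonical n (curryComb t)
  canonical-curryComb {zero} {A} {X} {Y} t@(gcomb M f₀ _) = begin
    t
      ≈⟨ step (boxwise ≈.refl (λ ())) ⟩
    gcomb M f₀ (λ i → noBoxes i ∘ (noWires i ⊗₁ id))
      ≈⟨ step (slide M [] noWires f₀ noBoxes) ⟩
    gcomb [] ((id ⊗₁ id) ∘ f₀) (λ i → (Hout M [] noWires (suc i) ⊗₁ id) ∘ noBoxes i)
      ≈⟨ step (boxwise unfold (λ ())) ⟩
    canonical zero (curryComb t)
      ∎
    where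
      open SetoidReasoning (GCombs zero A X Y)
      noWires : ∀ j → Hom (M j) ([] j)
      noWires ()
      noBoxes : ∀ i → Hom ([] i ⊗₀ X (suc i)) (Mout M (suc i) ⊗₀ Y (suc i))
      noBoxes ()
      unfold : (id ⊗₁ id) ∘ f₀ ≈ λ⇐ ∘ (eval ∘ (curry (λ⇒ ∘ f₀) ⊗₁ id))
      unfold = ≈.trans cancel-id⊗idˡ (≈.sym (≈.trans (∘-resp-≈ ≈.refl β)
                 (≈.trans (≈.sym assoc) (≈.trans (∘-resp-≈ λ-isoˡ ≈.refl) identityˡ))))
  canonical-curryComb {suc n} {A} {X} {Y} t@(gcomb M f₀ _) = begin
    t                                                 ≈⟨ cons-tail t ⟩
    cons f₀ (tail t)                                  ≈⟨ cons-cong f₀ (canonical-curryComb (tail t)) ⟩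
    cons f₀ (canonical n c)                           ≈⟨ cons-cong f₀ (canonical-precompose n c) ⟩
    cons f₀ (precompose c (canonical n id))           ≈⟨ cons-precompose f₀ c (canonical n id) ⟩
    cons ((c ⊗₁ id) ∘ f₀) (canonical n id)            ≈⟨ step (boxwise (≈.sym β) (λ _ → ≈.refl)) ⟩
    canonical (suc n) (curryComb t)                   ∎
    where
      open SetoidReasoning (GCombs (suc n) A X Y)
      c : Hom (M zero) (Z₀ n (λ i → X (suc i)) (λ i → Y (suc i)))
      c = curryComb (tail t)

  gcombRepresentation : ∀ n A X Y → Inverse (GCombs n A X Y) (homSetoid A (Z₀ n X Y))
  gcombRepresentation n A X Y = record
    { to        = curryComb
    ; from      = canonical n
    ; to-cong   = curryComb-cong
    ; from-cong = canonical-cong n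
    ; inverse   = (λ {k} p → ≈.trans (curryComb-cong p) (curryComb-canonical n k))
                , (λ {t} p → EqC.transitive GStep (canonical-cong n p)
                                                  (EqC.symmetric GStep (canonical-curryComb t)))
    }

  officialBoxes : ∀ {n} {X Y : Fin (suc n) → Obj} {N N' : Fin n → Obj} →
                  Hom (unit ⊗₀ X zero) (Mout N zero ⊗₀ Y zero) →
                  (∀ i → Hom (N' i ⊗₀ X (suc i)) (Mout N (suc i) ⊗₀ Y (suc i))) →
                  ∀ i → Hom (Min N' i ⊗₀ X i) (Mout N i ⊗₀ Y i)
  officialBoxes g₀ gs zero    = g₀
  officialBoxes g₀ gs (suc i) = gs i

  module _ (n : ℕ) (X Y : Fin (suc n) → Obj) where
    _≈C_ : Rel (PreComb n X Y) (o ⊔ ℓ ⊔ e)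
    _≈C_ = Setoid._≈_ (Comb n X Y)

    toGComb : PreComb n X Y → GComb n unit X Y
    toGComb (M , f) = gcomb M (f zero) (λ i → f (suc i))

    fromGComb : GComb n unit X Y → PreComb n X Y
    fromGComb (gcomb M f₀ fs) = M , officialBoxes {X = X} {Y = Y} f₀ fs

    toGComb-step : ∀ {c d} → CombStep n X Y c d → toGComb c ~ toGComb d
    toGComb-step (pointwise ps) = step (boxwise (ps zero) (λ i → ps (suc i)))
    toGComb-step (dinat M M' h g) = begin
      gcomb M (g zero ∘ (id ⊗₁ id)) (λ i → g (suc i) ∘ (h i ⊗₁ id))
        ≈⟨ step (boxwise cancel-id⊗idʳ (λ _ → ≈.refl)) ⟩
      gcomb M (g zero) (λ i → g (suc i) ∘ (h i ⊗₁ id))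
        ≈⟨ step (slide M M' h (g zero) (λ i → g (suc i))) ⟩
      toGComb (M' , λ i → (Hout M M' h i ⊗₁ id) ∘ g i)
        ∎
      where open SetoidReasoning (GCombs n unit X Y)

    fromGComb-step : ∀ {s t} → GStep s t → fromGComb s ≈C fromGComb t
    fromGComb-step (boxwise p ps) = EqC.return (pointwise λ { zero → p ; (suc i) → ps i })
    fromGComb-step (slide M M' h g₀ gs) = begin
      (M , officialBoxes g₀ (λ i → gs i ∘ (h i ⊗₁ id)))
        ≈⟨ EqC.return (pointwise λ { zero → ≈.sym cancel-id⊗idʳ ; (suc i) → ≈.refl }) ⟩
      (M , λ i → boxes i ∘ (Hin M M' h i ⊗₁ id))
        ≈⟨ EqC.return (dinat M M' h boxes) ⟩
      (M' , λ i → (Hout M M' h i ⊗₁ id) ∘ boxes i)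
        ≈⟨ EqC.return (pointwise λ { zero → ≈.refl ; (suc i) → ≈.refl }) ⟩
      (M' , officialBoxes ((Hout M M' h zero ⊗₁ id) ∘ g₀) (λ i → (Hout M M' h (suc i) ⊗₁ id) ∘ gs i))
        ∎
      where
        open SetoidReasoning (Comb n X Y)
        boxes : ∀ i → Hom (Min M' i ⊗₀ X i) (Mout M i ⊗₀ Y i)
        boxes = officialBoxes g₀ gs

    toGComb-cong : ∀ {c d} → c ≈C d → toGComb c ~ toGComb d
    toGComb-cong = EqC.gfold (EqC.isEquivalence GStep) toGComb toGComb-step

    fromGComb-cong : ∀ {s t} → s ~ t → fromGComb s ≈C fromGComb t
    fromGComb-cong = EqC.gfold (EqC.isEquivalence (CombStep n X Y)) fromGComb fromGComb-step

    fromGComb-toGComb : ∀ c → fromGComb (toGComb c) ≈C c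
    fromGComb-toGComb _ = EqC.return (pointwise λ { zero → ≈.refl ; (suc i) → ≈.refl })

    combsAsGCombs : Inverse (Comb n X Y) (GCombs n unit X Y)
    combsAsGCombs = record
      { to        = toGComb
      ; from      = fromGComb
      ; to-cong   = toGComb-cong
      ; from-cong = fromGComb-cong
      -- toGComb ∘ fromGComb is definitionally the identity.
      ; inverse   = toGComb-cong
                  , λ {c} {s} p → EqC.transitive (CombStep n X Y)
                                    (fromGComb-cong {s} {toGComb c} p) (fromGComb-toGComb c)
      }

mainTheorem5 : ∀ {o ℓ e : Level} (𝒞 : SMCC o ℓ e) (n : ℕ) (X Y : Fin (suc n) → SMCC.Obj 𝒞) →
    Inverse (Combs.Comb 𝒞 n X Y) (SMCC.homSetoid 𝒞 (SMCC.unit 𝒞) (Combs.Z₀ 𝒞 n X Y))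
mainTheorem5 𝒞 n X Y =
  Composition.inverse (combsAsGCombs n X Y) (gcombRepresentation n (SMCC.unit 𝒞) X Y)
  where open CombRepresentation 𝒞
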